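{- Let $e\geq 6$ be an integer and write $e=2s-1-\delta$ with $\delta\in \{0, 1\}$ and $s$ integers. If $e\neq 8, 12$, then at least one of the following statements holds. (a) $\delta=0$ and $\sigma^{**}(2^e)$ has at least two prime factors $q_1$ and $q_2$ with $5<q_1, q_2\leq 2^s-1$; (b) $5\mid\sigma^{**}(2^e)$; (c) $\sigma^{**}(2^e)$ has at least two prime factors $q_1$ and $q_2$ each of which satisfies either $q_i=2^{s-1}-1$, $q_i=2^s+1$, or $5<q_i\leq\sqrt{2^s-3}$. Moreover, if $q_i=2^{s-1}-1$ or $q_i=2^s+1$ for $i=1$ or $2$, then $4$ divides $s$ and $\delta=1$.
   Context: A divisor $d$ of a positive integer $N$ is a unitary divisor if $\gcd(d,N/d)=1$; $d$ is a biunitary divisor of $N$ if the greatest common unitary divisor of $d$ and $N/d$ is $1$. $\sigma^{**}(N)$ denotes the sum of the biunitary divisors of $N$. It is multiplicative, and for a prime $p$ and $e=2s-1-\delta$ with $\delta\in\{0,1\}$ one has $\sigma^{**}(p^e)=\frac{(p^{s-\delta}-1)(p^s+1)}{p-1}$ (i.e. $\sigma^{**}(p^e)=(p^{e+1}-1)/(p-1)$ for $e$ odd and $(p^{e+1}-1)/(p-1)-p^{e/2}$ for $e$ even). In particular $\sigma^{**}(2^e)=(2^s+1)(2^{s-\delta}-1)$. -}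

module Defs where

open import Data.Nat using (ℕ; zero; suc; _⊔_)
open import Data.Nat.Properties using (_≟_)
open import Data.Nat.DivMod using (_/_)
open import Data.Nat.GCD using (gcd)
open import Data.Nat.Divisibility using (_∣_; _∣?_)
open import Data.List using (List; map; filter; foldr; upTo)
open import Data.Nat.ListAction using (sum)
open import Data.Product using (_×_)
open import Relation.Binary.PropositionalEquality using (_≡_)
open import Relation.Nullary.Decidable using (Dec; _×-dec_)

-- N / d, with the (irrelevant) convention N / 0 = 0
quot : ℕ → ℕ → ℕ
quot N zero    = 0
quot N (suc k) = N / suc k

oneTo : ℕ → List ℕ
oneTo N = map suc (upTo N)

IsUnitaryDivisor : ℕ → ℕ → Set
IsUnitaryDivisor d N = d ∣ N × gcd d (quot N d) ≡ 1

isUnitaryDivisor? : ∀ d N → Dec (IsUnitaryDivisor d N)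
isUnitaryDivisor? d N = (d ∣? N) ×-dec (gcd d (quot N d) ≟ 1)

gcud : ℕ → ℕ → ℕ
gcud a b = foldr _⊔_ 0
  (filter (λ k → isUnitaryDivisor? k a ×-dec isUnitaryDivisor? k b) (oneTo a))

IsBiunitaryDivisor : ℕ → ℕ → Set
IsBiunitaryDivisor d N = d ∣ N × gcud d (quot N d) ≡ 1

isBiunitaryDivisor? : ∀ d N → Dec (IsBiunitaryDivisor d N)
isBiunitaryDivisor? d N = (d ∣? N) ×-dec (gcud d (quot N d) ≟ 1)

σ** : ℕ → ℕ
σ** N = sum (filter (λ d → isBiunitaryDivisor? d N) (oneTo N))

{-# OPTIONS --safe #-}
-- The biunitary divisors of a prime power p ^ e are the p ^ i with i ≠ e − i, so summing them
-- gives (p − 1) σ**(p ^ e) = (p ^ (s − δ) − 1)(p ^ s + 1), and σ**(2 ^ e) is that product for p = 2.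
-- Which alternative holds is decided by s mod 4.  If a factor is 2 ^ 4t − 1 or 2 ^ (4t + 2) + 1,
-- then 5 divides it: (b).  For x = 2 ^ (2u + 1) ≥ 32, x − 1 and (x + 1)/3 are prime to 30, and
-- (x + 1)/3 is no power of 3 (else x + 1 would be a power of 3 that is 1 mod 16, hence 1 mod 80,
-- but 5 ∤ x); so x − 1 and x + 1 have distinct prime factors in (5, x − 1].  Taking x = 2 ^ s
-- (δ = 0, s odd) gives (a); taking x² = 2 ^ (s − 1) (δ = 1, s ≡ 3 mod 4, s ≠ 7) gives (c).  In the
-- remaining case δ = 1, 4 ∣ s, the least prime factors of 2 ^ (s − 1) − 1 and 2 ^ s + 1 give (c).
module Submission where

open import Defs
open import Data.Empty using (⊥)
open import Data.Fin using (toℕ)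
open import Data.Fin.Patterns using (0F; 1F; 2F; 3F; 4F; 5F)
open import Data.Nat using (ℕ; zero; suc; _+_; _*_; _∸_; _^_; _≤_; _<_; _≤?_; _⊔_; z≤n; s≤s; z<s; NonZero; >-nonZero; >-nonZero⁻¹; nonTrivial⇒n>1; n>1⇒nonTrivial)
open import Data.Nat.Properties
open import Data.Nat.Divisibility
open import Data.Nat.DivMod using (_/_; _%_; _divMod_; result; m*n/n≡m; n/n≡1; [m+kn]%n≡m%n)
open import Data.Nat.GCD using (gcd; gcd-greatest; gcd[m,n]∣m; gcd[m,n]∣n; gcd-zeroˡ; gcd-zeroʳ)
open import Data.Nat.Coprimality using (Coprime; coprime-divisor; gcd≡1⇒coprime) renaming (sym to coprime-sym)
open import Data.Nat.Primality using (Prime; prime?; prime⇒irreducible; prime⇒nonZero; prime⇒nonTrivial; ¬prime[0]; ¬prime[1]; prime[2]; _Rough_; 2-rough; ∤⇒rough-suc; rough∧∣⇒prime; rough∧square>⇒prime)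
open import Data.Nat.Primality.Factorisation using (factorise; PrimeFactorisation)
open import Data.List using ([]; [_]; _++_; _∷ʳ_; map; filter; length; upTo; applyUpTo)
open import Data.List.Properties using (applyUpTo-∷ʳ; map-upTo; filter-++; filter-accept; filter-reject; ++-identityʳ; foldr-preservesᵇ; foldr-preservesᵒ)
open import Data.List.Relation.Unary.All as All using (All; all?)
open import Data.List.Relation.Unary.All.Properties using (all-filter; ¬All⇒Any¬)
open import Data.List.Relation.Unary.Any as Any using ()
open import Data.List.Membership.Propositional using (find)
open import Data.List.Membership.Propositional.Properties using (∈-map⁺; ∈-upTo⁺; ∈-filter⁺)
open import Data.Nat.ListAction using (sum; product)
open import Data.Nat.ListAction.Properties using (sum-++; ∈⇒∣product)
open import Data.Product using (_×_; _,_; ∃-syntax; proj₁; proj₂; uncurry)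
open import Data.Sum using (_⊎_; inj₁; inj₂; [_,_]′)
open import Function using (_∘_)
open import Relation.Binary.Definitions using (tri<; tri≈; tri>)
open import Relation.Binary.PropositionalEquality using (_≡_; _≢_; refl; sym; trans; cong; cong₂; subst; subst₂; ≢-sym; module ≡-Reasoning)
open import Relation.Nullary using (¬_; Dec; yes; no; contradiction; _×-dec_)
open import Relation.Nullary.Decidable using (from-no; True; False; toWitness; toWitnessFalse)
open import Relation.Unary using (Decidable)
open import Data.Nat.Tactic.RingSolver using (solve-∀)

private variable
  d i k m n p : ℕ

-- Divisors of prime powers

^-cancelʳ-< : 1 < p → ∀ m n → p ^ m < p ^ n → m < n
^-cancelʳ-< {p} 1<p m n p^m<p^n = ≰⇒> λ n≤m → <⇒≱ p^m<p^n (^-monoʳ-≤ p {{>-nonZero (<-trans z<s 1<p)}} n≤m)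

^-injectiveʳ : 1 < p → p ^ m ≡ p ^ n → m ≡ n
^-injectiveʳ {p} {m} {n} 1<p p^m≡p^n with <-cmp m n
... | tri< m<n _ _ = contradiction p^m≡p^n (<⇒≢ (^-monoʳ-< p 1<p m<n))
... | tri≈ _ m≡n _ = m≡n
... | tri> _ _ n<m = contradiction (sym p^m≡p^n) (<⇒≢ (^-monoʳ-< p 1<p n<m))

p^n≡p^i*p^[n∸i] : ∀ p i n → i ≤ n → p ^ n ≡ p ^ i * p ^ (n ∸ i)
p^n≡p^i*p^[n∸i] p i n i≤n = trans (cong (p ^_) (sym (m+[n∸m]≡n i≤n))) (^-distribˡ-+-* p i (n ∸ i))

p∣p^n : ∀ p n → 0 < n → p ∣ p ^ n
p∣p^n p (suc n) _ = m∣m*n (p ^ n)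

prime⇒>1 : Prime p → 1 < p
prime⇒>1 {p} pr = nonTrivial⇒n>1 p {{prime⇒nonTrivial pr}}

prime∤⇒coprime : Prime p → ¬ p ∣ n → Coprime p n
prime∤⇒coprime {p} {n} pr p∤n with prime⇒irreducible pr (gcd[m,n]∣m p n)
... | inj₁ gcd≡1 = gcd≡1⇒coprime gcd≡1
... | inj₂ gcd≡p = contradiction (subst (_∣ n) gcd≡p (gcd[m,n]∣n p n)) p∤n

∣p^n⇒≡p^i : Prime p → ∀ n → d ∣ p ^ n → ∃[ i ] (i ≤ n × d ≡ p ^ i)
∣p^n⇒≡p^i pr zero d∣1 = 0 , z≤n , ∣1⇒≡1 d∣1
∣p^n⇒≡p^i {p} {d} pr (suc n) d∣p^[1+n] with p ∣? d
... | yes (divides d′ refl) =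
  let i , i≤n , d′≡p^i = ∣p^n⇒≡p^i pr n d′∣p^n in suc i , s≤s i≤n , trans (*-comm d′ p) (cong (p *_) d′≡p^i)
  where
  instance _ = prime⇒nonZero pr
  d′∣p^n : d′ ∣ p ^ n
  d′∣p^n = *-cancelˡ-∣ p (subst (_∣ p * p ^ n) (*-comm d′ p) d∣p^[1+n])
... | no p∤d =
  let i , i≤n , d≡p^i = ∣p^n⇒≡p^i pr n (coprime-divisor (coprime-sym (prime∤⇒coprime pr p∤d)) d∣p^[1+n])
  in i , m≤n⇒m≤1+n i≤n , d≡p^i

quot[m*n,m]≡n : ∀ m n .{{_ : NonZero m}} → quot (m * n) m ≡ n
quot[m*n,m]≡n (suc m) n = trans (cong (_/ suc m) (*-comm (suc m) n)) (m*n/n≡m n (suc m))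

quot[p^n,p^i]≡p^[n∸i] : Prime p → ∀ i n → i ≤ n → quot (p ^ n) (p ^ i) ≡ p ^ (n ∸ i)
quot[p^n,p^i]≡p^[n∸i] {p} pr i n i≤n = trans (cong (λ x → quot x (p ^ i)) (p^n≡p^i*p^[n∸i] p i n i≤n))
  (quot[m*n,m]≡n (p ^ i) (p ^ (n ∸ i)) {{m^n≢0 p i {{prime⇒nonZero pr}}}})

isUnitaryDivisor-1 : ∀ n → IsUnitaryDivisor 1 n
isUnitaryDivisor-1 n = 1∣ n , gcd-zeroˡ (quot n 1)

isUnitaryDivisor-diag : ∀ n .{{_ : NonZero n}} → IsUnitaryDivisor n n
isUnitaryDivisor-diag (suc n) = ∣-refl , trans (cong (gcd (suc n)) (n/n≡1 (suc n))) (gcd-zeroʳ (suc n))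

isUnitaryDivisor[p^n]⇒≡1∨≡p^n : Prime p → ∀ n → IsUnitaryDivisor d (p ^ n) → d ≡ 1 ⊎ d ≡ p ^ n
isUnitaryDivisor[p^n]⇒≡1∨≡p^n {p} {d} pr n (d∣p^n , gcd≡1) with ∣p^n⇒≡p^i pr n d∣p^n
... | zero , _ , d≡1 = inj₁ d≡1
... | suc i , 1+i≤n , refl with m≤n⇒m<n∨m≡n 1+i≤n
...   | inj₂ 1+i≡n = inj₂ (cong (p ^_) 1+i≡n)
...   | inj₁ 1+i<n = contradiction (subst Prime p≡1 pr) ¬prime[1]
  where
  p∣quot : p ∣ quot (p ^ n) (p ^ suc i)
  p∣quot = subst (p ∣_) (sym (quot[p^n,p^i]≡p^[n∸i] pr (suc i) n 1+i≤n)) (p∣p^n p (n ∸ suc i) (m<n⇒0<n∸m 1+i<n))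
  p≡1 : p ≡ 1
  p≡1 = ∣1⇒≡1 (subst (p ∣_) gcd≡1 (gcd-greatest (p∣p^n p (suc i) z<s) p∣quot))

gcud-lub : (∀ {k} → IsUnitaryDivisor k m → IsUnitaryDivisor k n → k ≤ d) → gcud m n ≤ d
gcud-lub {m} {n} bound = foldr-preservesᵇ ⊔-lub z≤n
  (All.map (uncurry bound) (all-filter (λ k → isUnitaryDivisor? k m ×-dec isUnitaryDivisor? k n) (oneTo m)))

≤-gcud : 0 < k → k ≤ m → IsUnitaryDivisor k m → IsUnitaryDivisor k n → k ≤ gcud m n
≤-gcud {suc k} {m} {n} _ k≤m k∥m k∥n = foldr-preservesᵒ
  (λ x y → [ (λ k≤x → ≤-trans k≤x (m≤m⊔n x y)) , m≤n⇒m≤o⊔n x ]′) 0 _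
  (inj₂ (Any.map ≤-reflexive (∈-filter⁺ (λ k → isUnitaryDivisor? k m ×-dec isUnitaryDivisor? k n)
    (∈-map⁺ suc (∈-upTo⁺ k≤m)) (k∥m , k∥n))))

gcud-diag : ∀ n .{{_ : NonZero n}} → gcud n n ≡ n
gcud-diag n = ≤-antisym (gcud-lub λ (k∣n , _) _ → ∣⇒≤ k∣n)
  (≤-gcud (>-nonZero⁻¹ n) ≤-refl (isUnitaryDivisor-diag n) (isUnitaryDivisor-diag n))

gcud[p^i,p^j]≡1 : Prime p → ∀ i j → i ≢ j → gcud (p ^ i) (p ^ j) ≡ 1
gcud[p^i,p^j]≡1 {p} pr i j i≢j = ≤-antisym (gcud-lub common≤1)
  (≤-gcud z<s (m^n>0 p {{prime⇒nonZero pr}} i) (isUnitaryDivisor-1 _) (isUnitaryDivisor-1 _))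
  where
  common≤1 : ∀ {k} → IsUnitaryDivisor k (p ^ i) → IsUnitaryDivisor k (p ^ j) → k ≤ 1
  common≤1 k∥p^i k∥p^j with isUnitaryDivisor[p^n]⇒≡1∨≡p^n pr i k∥p^i | isUnitaryDivisor[p^n]⇒≡1∨≡p^n pr j k∥p^j
  ... | inj₁ k≡1 | _ = ≤-reflexive k≡1
  ... | inj₂ _ | inj₁ k≡1 = ≤-reflexive k≡1
  ... | inj₂ k≡p^i | inj₂ k≡p^j = contradiction (^-injectiveʳ (prime⇒>1 pr) (trans (sym k≡p^i) k≡p^j)) i≢j

isBiunitaryDivisor[p^i,p^n] : Prime p → ∀ i n → i ≤ n → i ≢ n ∸ i → IsBiunitaryDivisor (p ^ i) (p ^ n)
isBiunitaryDivisor[p^i,p^n] {p} pr i n i≤n i≢n∸i =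
  subst (p ^ i ∣_) (sym (p^n≡p^i*p^[n∸i] p i n i≤n)) (m∣m*n _) ,
  trans (cong (gcud (p ^ i)) (quot[p^n,p^i]≡p^[n∸i] pr i n i≤n)) (gcud[p^i,p^j]≡1 pr i (n ∸ i) i≢n∸i)

¬isBiunitaryDivisor[d,d*d] : 1 < d → ¬ IsBiunitaryDivisor d (d * d)
¬isBiunitaryDivisor[d,d*d] {d} 1<d (_ , gcud≡1) = <⇒≢ 1<d (begin
  1                      ≡⟨ gcud≡1 ⟨
  gcud d (quot (d * d) d) ≡⟨ cong (gcud d) (quot[m*n,m]≡n d d) ⟩
  gcud d d               ≡⟨ gcud-diag d ⟩
  d                      ∎)
  where
  open ≡-Reasoning
  instance _ = >-nonZero (<-trans z<s 1<d)

-- σ** of a prime power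

oneTo-suc : ∀ n → oneTo (suc n) ≡ oneTo n ∷ʳ suc n
oneTo-suc n = begin
  map suc (upTo (suc n))       ≡⟨ map-upTo suc (suc n) ⟩
  applyUpTo suc (suc n)        ≡⟨ applyUpTo-∷ʳ suc n ⟨
  applyUpTo suc n ∷ʳ suc n     ≡⟨ cong (_∷ʳ suc n) (map-upTo suc n) ⟨
  map suc (upTo n) ∷ʳ suc n    ∎
  where open ≡-Reasoning

q*[m+x]+1≡q*m+1+q*x : ∀ q m x → q * (m + x) + 1 ≡ (q * m + 1) + q * x
q*[m+x]+1≡q*m+1+q*x = solve-∀

module _ {P : ℕ → Set} (P? : Decidable P) where

  filter-oneTo-step : m < n → (∀ {d} → m < d → d < n → ¬ P d) →
                      filter P? (oneTo n) ≡ filter P? (oneTo m) ++ filter P? [ n ]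
  filter-oneTo-step {m} {suc n} (s≤s m≤n) gap with m≤n⇒m<n∨m≡n m≤n
  ... | inj₂ refl = trans (cong (filter P?) (oneTo-suc m)) (filter-++ P? (oneTo m) [ suc m ])
  ... | inj₁ m<n = begin
    filter P? (oneTo (suc n))                               ≡⟨ cong (filter P?) (oneTo-suc n) ⟩
    filter P? (oneTo n ∷ʳ suc n)                            ≡⟨ filter-++ P? (oneTo n) [ suc n ] ⟩
    filter P? (oneTo n) ++ filter P? [ suc n ]              ≡⟨ cong (_++ filter P? [ suc n ]) ind ⟩
    filter P? (oneTo m) ++ filter P? [ suc n ]              ∎
    where
    open ≡-Reasoning
    ind : filter P? (oneTo n) ≡ filter P? (oneTo m)
    ind = begin
      filter P? (oneTo n)                       ≡⟨ filter-oneTo-step m<n (λ m<d d<n → gap m<d (m<n⇒m<1+n d<n)) ⟩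
      filter P? (oneTo m) ++ filter P? [ n ]    ≡⟨ cong (filter P? (oneTo m) ++_) (filter-reject P? (gap m<n (n<1+n n))) ⟩
      filter P? (oneTo m) ++ []                 ≡⟨ ++-identityʳ _ ⟩
      filter P? (oneTo m)                       ∎

  filter-oneTo-p^n : 1 < p → (∀ {d} → P d → ∃[ i ] d ≡ p ^ i) → ∀ n →
                     filter P? (oneTo (p ^ n)) ≡ filter P? (applyUpTo (p ^_) (suc n))
  filter-oneTo-p^n 1<p powers zero = refl
  filter-oneTo-p^n {p} 1<p powers (suc n) = begin
    filter P? (oneTo (p ^ suc n))                                   ≡⟨ filter-oneTo-step (^-monoʳ-< p 1<p (n<1+n n)) gap ⟩
    filter P? (oneTo (p ^ n)) ++ filter P? [ p ^ suc n ]            ≡⟨ cong (_++ filter P? [ p ^ suc n ]) (filter-oneTo-p^n 1<p powers n) ⟩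
    filter P? (applyUpTo (p ^_) (suc n)) ++ filter P? [ p ^ suc n ] ≡⟨ filter-++ P? (applyUpTo (p ^_) (suc n)) [ p ^ suc n ] ⟨
    filter P? (applyUpTo (p ^_) (suc n) ∷ʳ p ^ suc n)               ≡⟨ cong (filter P?) (applyUpTo-∷ʳ (p ^_) (suc n)) ⟩
    filter P? (applyUpTo (p ^_) (suc (suc n)))                      ∎
    where
    open ≡-Reasoning
    gap : ∀ {d} → p ^ n < d → d < p ^ suc n → ¬ P d
    gap p^n<d d<p^[1+n] Pd with powers Pd
    ... | i , refl = <⇒≱ (^-cancelʳ-< 1<p n i p^n<d) (≤-pred (^-cancelʳ-< 1<p i (suc n) d<p^[1+n]))

  powerSum : ℕ → ℕ → ℕ
  powerSum p n = sum (filter P? (applyUpTo (p ^_) n))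

  powerSum-suc : ∀ p n → powerSum p (suc n) ≡ powerSum p n + sum (filter P? [ p ^ n ])
  powerSum-suc p n = begin
    sum (filter P? (applyUpTo (p ^_) (suc n)))  ≡⟨ cong (sum ∘ filter P?) (applyUpTo-∷ʳ (p ^_) n) ⟨
    sum (filter P? (xs ++ [ p ^ n ]))           ≡⟨ cong sum (filter-++ P? xs [ p ^ n ]) ⟩
    sum (filter P? xs ++ filter P? [ p ^ n ])   ≡⟨ sum-++ (filter P? xs) (filter P? [ p ^ n ]) ⟩
    powerSum p n + sum (filter P? [ p ^ n ])    ∎
    where
    open ≡-Reasoning
    xs = applyUpTo (p ^_) n

  powerSum-accept : ∀ p n → P (p ^ n) → powerSum p (suc n) ≡ powerSum p n + p ^ n
  powerSum-accept p n P[p^n] = trans (powerSum-suc p n)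
    (trans (cong (λ ys → powerSum p n + sum ys) (filter-accept P? P[p^n])) (cong (powerSum p n +_) (+-identityʳ (p ^ n))))

  powerSum-reject : ∀ p n → ¬ P (p ^ n) → powerSum p (suc n) ≡ powerSum p n
  powerSum-reject p n ¬P[p^n] = trans (powerSum-suc p n)
    (trans (cong (λ ys → powerSum p n + sum ys) (filter-reject P? ¬P[p^n])) (+-identityʳ (powerSum p n)))

  geometric-series : ∀ p n .{{_ : NonZero p}} → (∀ {i} → i < n → P (p ^ i)) →
                     (p ∸ 1) * powerSum p n + 1 ≡ p ^ n
  geometric-series p zero _ = cong (_+ 1) (*-zeroʳ (p ∸ 1))
  geometric-series p@(suc q) (suc n) accept = begin
    q * powerSum p (suc n) + 1          ≡⟨ cong (λ m → q * m + 1) (powerSum-accept p n (accept (n<1+n n))) ⟩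
    q * (powerSum p n + p ^ n) + 1      ≡⟨ q*[m+x]+1≡q*m+1+q*x q (powerSum p n) (p ^ n) ⟩
    (q * powerSum p n + 1) + q * p ^ n  ≡⟨ cong (_+ q * p ^ n) (geometric-series p n (accept ∘ m<n⇒m<1+n)) ⟩
    p ^ n + q * p ^ n                   ∎
    where open ≡-Reasoning

  geometric-series-without : ∀ p c n .{{_ : NonZero p}} → c < n →
                             (∀ {i} → i < n → i ≢ c → P (p ^ i)) → ¬ P (p ^ c) →
                             (p ∸ 1) * (powerSum p n + p ^ c) + 1 ≡ p ^ n
  geometric-series-without p@(suc q) c (suc n) (s≤s c≤n) accept reject with m≤n⇒m<n∨m≡n c≤n
  ... | inj₂ refl = begin
    q * (powerSum p (suc c) + p ^ c) + 1  ≡⟨ cong (λ m → q * (m + p ^ c) + 1) (powerSum-reject p c reject) ⟩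
    q * (powerSum p c + p ^ c) + 1        ≡⟨ q*[m+x]+1≡q*m+1+q*x q (powerSum p c) (p ^ c) ⟩
    (q * powerSum p c + 1) + q * p ^ c    ≡⟨ cong (_+ q * p ^ c) (geometric-series p c below-c) ⟩
    p ^ c + q * p ^ c                     ∎
    where
    open ≡-Reasoning
    below-c : ∀ {i} → i < c → P (p ^ i)
    below-c i<c = accept (m<n⇒m<1+n i<c) (<⇒≢ i<c)
  ... | inj₁ c<n = begin
    q * (powerSum p (suc n) + p ^ c) + 1          ≡⟨ cong (λ m → q * (m + p ^ c) + 1) (powerSum-accept p n P[p^n]) ⟩
    q * ((powerSum p n + p ^ n) + p ^ c) + 1      ≡⟨ regroup q (powerSum p n) (p ^ n) (p ^ c) ⟩
    (q * (powerSum p n + p ^ c) + 1) + q * p ^ n  ≡⟨ cong (_+ q * p ^ n) below-n ⟩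
    p ^ n + q * p ^ n                             ∎
    where
    open ≡-Reasoning
    P[p^n] = accept (n<1+n n) (≢-sym (<⇒≢ c<n))
    below-n = geometric-series-without p c n c<n (accept ∘ m<n⇒m<1+n) reject
    regroup : ∀ q m x y → q * ((m + x) + y) + 1 ≡ (q * (m + y) + 1) + q * x
    regroup = solve-∀

σ**[p^e]≡powerSum : Prime p → ∀ e → σ** (p ^ e) ≡ powerSum (λ d → isBiunitaryDivisor? d (p ^ e)) p (suc e)
σ**[p^e]≡powerSum {p} pr e = cong sum (filter-oneTo-p^n (λ d → isBiunitaryDivisor? d (p ^ e)) (prime⇒>1 pr) power e)
  where
  power : ∀ {d} → IsBiunitaryDivisor d (p ^ e) → ∃[ i ] d ≡ p ^ i
  power (d∣p^e , _) = let i , _ , d≡p^i = ∣p^n⇒≡p^i pr e d∣p^e in i , d≡p^i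

m+m≡n+n⇒m≡n : m + m ≡ n + n → m ≡ n
m+m≡n+n⇒m≡n {m} {n} eq = *-cancelˡ-≡ m n 2 (trans (cong (m +_) (+-identityʳ m)) (trans eq (cong (n +_) (sym (+-identityʳ n)))))

m+m≢1+n+n : ∀ m n → m + m ≢ suc (n + n)
m+m≢1+n+n m n eq = even≢odd m n (trans (cong (m +_) (+-identityʳ m)) (trans eq (cong (λ k → suc (n + k)) (sym (+-identityʳ n)))))

i≡n∸i⇒i+i≡n : i ≤ n → i ≡ n ∸ i → i + i ≡ n
i≡n∸i⇒i+i≡n {i} i≤n i≡n∸i = trans (cong (i +_) i≡n∸i) (m+[n∸m]≡n i≤n)

σ**[p^odd] : Prime p → ∀ e s → suc e ≡ s + s → (p ∸ 1) * σ** (p ^ e) + 1 ≡ p ^ s * p ^ s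
σ**[p^odd] {p} pr e s 1+e≡s+s = begin
  (p ∸ 1) * σ** (p ^ e) + 1              ≡⟨ cong (λ m → (p ∸ 1) * m + 1) (σ**[p^e]≡powerSum pr e) ⟩
  (p ∸ 1) * powerSum Bi? p (suc e) + 1   ≡⟨ geometric-series Bi? p (suc e) accept ⟩
  p ^ suc e                              ≡⟨ cong (p ^_) 1+e≡s+s ⟩
  p ^ (s + s)                            ≡⟨ ^-distribˡ-+-* p s s ⟩
  p ^ s * p ^ s                          ∎
  where
  open ≡-Reasoning
  instance _ = prime⇒nonZero pr
  Bi? = λ d → isBiunitaryDivisor? d (p ^ e)
  accept : ∀ {i} → i < suc e → IsBiunitaryDivisor (p ^ i) (p ^ e)
  accept {i} (s≤s i≤e) = isBiunitaryDivisor[p^i,p^n] pr i e i≤e λ i≡e∸i →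
    m+m≢1+n+n s i (trans (sym 1+e≡s+s) (cong suc (sym (i≡n∸i⇒i+i≡n i≤e i≡e∸i))))

σ**[p^even] : Prime p → ∀ c → 0 < c → (p ∸ 1) * (σ** (p ^ (c + c)) + p ^ c) + 1 ≡ p * (p ^ c * p ^ c)
σ**[p^even] {p} pr c 0<c = begin
  (p ∸ 1) * (σ** (p ^ (c + c)) + p ^ c) + 1            ≡⟨ cong (λ m → (p ∸ 1) * (m + p ^ c) + 1) (σ**[p^e]≡powerSum pr (c + c)) ⟩
  (p ∸ 1) * (powerSum Bi? p (suc (c + c)) + p ^ c) + 1 ≡⟨ geometric-series-without Bi? p c (suc (c + c)) (s≤s (m≤m+n c c)) accept reject ⟩
  p * p ^ (c + c)                                      ≡⟨ cong (p *_) (^-distribˡ-+-* p c c) ⟩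
  p * (p ^ c * p ^ c)                                  ∎
  where
  open ≡-Reasoning
  instance _ = prime⇒nonZero pr
  Bi? = λ d → isBiunitaryDivisor? d (p ^ (c + c))
  accept : ∀ {i} → i < suc (c + c) → i ≢ c → IsBiunitaryDivisor (p ^ i) (p ^ (c + c))
  accept {i} (s≤s i≤c+c) i≢c = isBiunitaryDivisor[p^i,p^n] pr i (c + c) i≤c+c λ i≡c+c∸i →
    i≢c (m+m≡n+n⇒m≡n (i≡n∸i⇒i+i≡n i≤c+c i≡c+c∸i))
  reject : ¬ IsBiunitaryDivisor (p ^ c) (p ^ (c + c))
  reject = subst (λ N → ¬ IsBiunitaryDivisor (p ^ c) N) (sym (^-distribˡ-+-* p c c))
    (¬isBiunitaryDivisor[d,d*d] (^-monoʳ-< p (prime⇒>1 pr) 0<c))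

σ**[p^e] : Prime p → ∀ e s δ → δ ≤ 1 → e + 1 + δ ≡ 2 * s → 0 < e →
           (p ∸ 1) * σ** (p ^ e) ≡ (p ^ (s ∸ δ) ∸ 1) * (p ^ s + 1)
σ**[p^e] {p} pr e s zero _ e+1+0≡2s _ =
  difference-of-squares (σ** (p ^ e)) (p ^ s) (m^n>0 p s) (σ**[p^odd] pr e s 1+e≡s+s)
  where
  instance _ = prime⇒nonZero pr
  1+e≡s+s : suc e ≡ s + s
  1+e≡s+s = trans (+-comm 1 e) (trans (sym (+-identityʳ (e + 1))) (trans e+1+0≡2s (cong (s +_) (+-identityʳ s))))
  difference-of-squares : ∀ m x → 0 < x → (p ∸ 1) * m + 1 ≡ x * x → (p ∸ 1) * m ≡ (x ∸ 1) * (x + 1)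
  difference-of-squares m (suc y) _ eq = +-cancelʳ-≡ 1 _ _ (trans eq (square y))
    where
    square : ∀ y → suc y * suc y ≡ y * (suc y + 1) + 1
    square = solve-∀
σ**[p^e] pr e zero (suc zero) _ e+2≡0 _ = contradiction e+2≡0 (m+1+n≢0 (e + 1) {0})
σ**[p^e] {p@(suc q)} pr e (suc c) (suc zero) _ e+2≡2[1+c] 0<e =
  subst (λ n → q * σ** (p ^ n) ≡ (p ^ c ∸ 1) * (p ^ suc c + 1)) (sym e≡c+c)
    (near-square (σ** (p ^ (c + c))) (p ^ c) (m^n>0 p c) (σ**[p^even] pr c 0<c))
  where
  e≡c+c : e ≡ c + c
  e≡c+c = suc-injective (suc-injective (trans (+2 e) (trans e+2≡2[1+c] (2*[1+c] c))))
    where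
    +2 : ∀ e → suc (suc e) ≡ e + 1 + 1
    +2 = solve-∀
    2*[1+c] : ∀ c → 2 * suc c ≡ suc (suc (c + c))
    2*[1+c] = solve-∀
  0<c : 0 < c
  0<c = n≢0⇒n>0 λ c≡0 → <⇒≢ 0<e (sym (trans e≡c+c (cong (λ c → c + c) c≡0)))
  near-square : ∀ m y → 0 < y → q * (m + y) + 1 ≡ p * (y * y) → q * m ≡ (y ∸ 1) * (p * y + 1)
  near-square m (suc z) _ eq = +-cancelʳ-≡ (q * suc z + 1) _ _ (begin
    q * m + (q * suc z + 1)                   ≡⟨ regroup q m (suc z) ⟩
    q * (m + suc z) + 1                       ≡⟨ eq ⟩
    suc q * (suc z * suc z)                   ≡⟨ factor q z ⟩
    z * (suc q * suc z + 1) + (q * suc z + 1) ∎)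
    where
    open ≡-Reasoning
    regroup : ∀ q m y → q * m + (q * y + 1) ≡ q * (m + y) + 1
    regroup = solve-∀
    factor : ∀ q z → suc q * (suc z * suc z) ≡ z * (suc q * suc z + 1) + (q * suc z + 1)
    factor = solve-∀
σ**[p^e] _ _ _ (suc (suc _)) (s≤s ()) _ _

σ**[2^e] : ∀ e s δ → δ ≤ 1 → e + 1 + δ ≡ 2 * s → 0 < e → σ** (2 ^ e) ≡ (2 ^ (s ∸ δ) ∸ 1) * (2 ^ s + 1)
σ**[2^e] e s δ δ≤1 e+1+δ≡2s 0<e = trans (sym (*-identityˡ (σ** (2 ^ e)))) (σ**[p^e] prime[2] e s δ δ≤1 e+1+δ≡2s 0<e)

-- Congruences and prime factors

m^k≡1+d⇒m^[t*k]≡1+c*d : ∀ m k d → m ^ k ≡ 1 + d → ∀ t → ∃[ c ] m ^ (t * k) ≡ 1 + c * d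
m^k≡1+d⇒m^[t*k]≡1+c*d m k d m^k≡1+d zero = 0 , refl
m^k≡1+d⇒m^[t*k]≡1+c*d m k d m^k≡1+d (suc t) =
  let c , m^[t*k]≡1+c*d = m^k≡1+d⇒m^[t*k]≡1+c*d m k d m^k≡1+d t in
  suc c + c * d , (begin
    m ^ (k + t * k)           ≡⟨ ^-distribˡ-+-* m k (t * k) ⟩
    m ^ k * m ^ (t * k)       ≡⟨ cong₂ _*_ m^k≡1+d m^[t*k]≡1+c*d ⟩
    (1 + d) * (1 + c * d)     ≡⟨ expand c d ⟩
    1 + (suc c + c * d) * d   ∎)
  where
  open ≡-Reasoning
  expand : ∀ c d → (1 + d) * (1 + c * d) ≡ 1 + (suc c + c * d) * d
  expand = solve-∀

∤r+k*n : ∀ {d} r n k → {True (d ∣? n)} → {False (d ∣? r)} → ¬ d ∣ r + k * n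
∤r+k*n {d} r n k {d∣n} {d∤r} d∣r+k*n =
  toWitnessFalse d∤r (∣m+n∣m⇒∣n (subst (d ∣_) (+-comm r (k * n)) d∣r+k*n) (∣n⇒∣m*n k (toWitness d∣n)))

m+kn≡o+ln⇒m%n≡o%n : ∀ m k o l n .{{_ : NonZero n}} → m + k * n ≡ o + l * n → m % n ≡ o % n
m+kn≡o+ln⇒m%n≡o%n m k o l n eq =
  trans (sym ([m+kn]%n≡m%n m k n)) (trans (cong (_% n) eq) ([m+kn]%n≡m%n o l n))

a*d≤r+m*d⇒a≤m : ∀ d a m r → a * d ≤ r + m * d → r < d → a ≤ m
a*d≤r+m*d⇒a≤m d a m r a*d≤r+m*d r<d = ≤-pred (*-cancelʳ-< d a (suc m) (≤-<-trans a*d≤r+m*d (+-monoˡ-< (m * d) r<d)))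

n≤2n∸3 : ∀ n → 3 ≤ n → n ≤ 2 * n ∸ 3
n≤2n∸3 n 3≤n = subst (n ≤_) n+[n∸3]≡2n∸3 (m≤m+n n (n ∸ 3))
  where
  n+[n∸3]≡2n∸3 : n + (n ∸ 3) ≡ 2 * n ∸ 3
  n+[n∸3]≡2n∸3 = trans (sym (+-∸-assoc n 3≤n)) (cong (λ m → n + m ∸ 3) (sym (+-identityʳ n)))

prime>5 : ∀ {p} → Prime p → p ≢ 2 → p ≢ 3 → p ≢ 5 → 5 < p
prime>5 {0} pr = contradiction pr ¬prime[0]
prime>5 {1} pr = contradiction pr ¬prime[1]
prime>5 {2} _ p≢2 = contradiction refl p≢2
prime>5 {3} _ _ p≢3 = contradiction refl p≢3
prime>5 {4} pr = contradiction pr (from-no (prime? 4))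
prime>5 {5} _ _ _ p≢5 = contradiction refl p≢5
prime>5 {suc (suc (suc (suc (suc (suc p)))))} _ _ _ _ = s≤s (s≤s (s≤s (s≤s (s≤s (s≤s z≤n)))))

∣∧∤⇒≢ : ∀ {p} → p ∣ n → ¬ d ∣ n → p ≢ d
∣∧∤⇒≢ p∣n d∤n refl = d∤n p∣n

prime∣n⇒5<p : ∀ {p} → Prime p → p ∣ n → ¬ 2 ∣ n → ¬ 3 ∣ n → ¬ 5 ∣ n → 5 < p
prime∣n⇒5<p pr p∣n 2∤n 3∤n 5∤n = prime>5 pr (∣∧∤⇒≢ p∣n 2∤n) (∣∧∤⇒≢ p∣n 3∤n) (∣∧∤⇒≢ p∣n 5∤n)

square≡1[mod12] : ∀ q → ¬ 2 ∣ q → ¬ 3 ∣ q → ∃[ a ] q * q ≡ 1 + a * 12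
square≡1[mod12] q 2∤q 3∤q with q divMod 6
... | result h 0F refl = contradiction (∣n⇒∣m*n h (divides 3 refl)) 2∤q
... | result h 1F refl = h + 3 * h * h , expand h
  where
  expand : ∀ h → (1 + h * 6) * (1 + h * 6) ≡ 1 + (h + 3 * h * h) * 12
  expand = solve-∀
... | result h 2F refl = contradiction (∣m∣n⇒∣m+n (divides 1 refl) (∣n⇒∣m*n h (divides 3 refl))) 2∤q
... | result h 3F refl = contradiction (∣m∣n⇒∣m+n (divides 1 refl) (∣n⇒∣m*n h (divides 2 refl))) 3∤q
... | result h 4F refl = contradiction (∣m∣n⇒∣m+n (divides 2 refl) (∣n⇒∣m*n h (divides 3 refl))) 2∤q
... | result h 5F refl = 2 + 5 * h + 3 * h * h , expand h
  where
  expand : ∀ h → (5 + h * 6) * (5 + h * 6) ≡ 1 + (2 + 5 * h + 3 * h * h) * 12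
  expand = solve-∀

square≤5+m*12⇒≤1+m*12 : ∀ q m → ¬ 2 ∣ q → ¬ 3 ∣ q → q * q ≤ 5 + m * 12 → q * q ≤ 1 + m * 12
square≤5+m*12⇒≤1+m*12 q m 2∤q 3∤q q²≤5+m*12 with square≡1[mod12] q 2∤q 3∤q
... | a , q²≡1+a*12 = subst (_≤ 1 + m * 12) (sym q²≡1+a*12)
  (s≤s (*-monoˡ-≤ 12 (a*d≤r+m*d⇒a≤m 12 a m 4 a*12≤4+m*12 (s≤s (s≤s (s≤s (s≤s (s≤s z≤n))))))))
  where
  a*12≤4+m*12 : a * 12 ≤ 4 + m * 12
  a*12≤4+m*12 = ≤-pred (subst (_≤ 5 + m * 12) q²≡1+a*12 q²≤5+m*12)

5∣2^[t*4]∸1 : ∀ t → 5 ∣ 2 ^ (t * 4) ∸ 1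
5∣2^[t*4]∸1 t with m^k≡1+d⇒m^[t*k]≡1+c*d 2 4 15 refl t
... | c , 2^[t*4]≡1+c*15 = subst (λ x → 5 ∣ x ∸ 1) (sym 2^[t*4]≡1+c*15) (∣n⇒∣m*n c (divides 3 refl))

5∣2^[2+t*4]+1 : ∀ t → 5 ∣ 2 ^ (2 + t * 4) + 1
5∣2^[2+t*4]+1 t with m^k≡1+d⇒m^[t*k]≡1+c*d 2 4 15 refl t
... | c , 2^[t*4]≡1+c*15 = divides (1 + c * 12) (trans (cong (λ x → 2 * (2 * x) + 1) 2^[t*4]≡1+c*15) (expand c))
  where
  expand : ∀ c → 2 * (2 * (1 + c * 15)) + 1 ≡ (1 + c * 12) * 5
  expand = solve-∀

2^[3+t*4]≡8+c*120 : ∀ t → ∃[ c ] (2 ^ (3 + t * 4) ≡ 8 + c * 120 × 2 ^ (4 + t * 4) ≡ 16 + c * 240)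
2^[3+t*4]≡8+c*120 t with m^k≡1+d⇒m^[t*k]≡1+c*d 2 4 15 refl t
... | c , 2^[t*4]≡1+c*15 = c , trans (cong (λ y → 2 * (2 * (2 * y))) 2^[t*4]≡1+c*15) (times8 c)
                            , trans (cong (λ y → 2 * (2 * (2 * (2 * y)))) 2^[t*4]≡1+c*15) (times16 c)
  where
  times8 : ∀ c → 2 * (2 * (2 * (1 + c * 15))) ≡ 8 + c * 120
  times8 = solve-∀
  times16 : ∀ c → 2 * (2 * (2 * (2 * (1 + c * 15)))) ≡ 16 + c * 240
  times16 = solve-∀

5∤2^n : ∀ n → ¬ 5 ∣ 2 ^ n
5∤2^n n 5∣2^n with ∣p^n⇒≡p^i prime[2] n 5∣2^n
... | zero , _ , ()
... | suc i , _ , 5≡2*2^i = from-no (2 ∣? 5) (divides (2 ^ i) (trans 5≡2*2^i (*-comm 2 (2 ^ i))))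

2^[4+w]+1≢3^j : ∀ w j → 2 ^ (4 + w) + 1 ≢ 3 ^ j
2^[4+w]+1≢3^j w j eq with j divMod 4
... | result t r refl with m^k≡1+d⇒m^[t*k]≡1+c*d 3 4 80 refl t
...   | c , 3^[t*4]≡1+c*80 = mismatch r (begin
  1 + 2 ^ w * 16                ≡⟨ lhs (2 ^ w) ⟩
  2 ^ (4 + w) + 1               ≡⟨ eq ⟩
  3 ^ (toℕ r + t * 4)           ≡⟨ ^-distribˡ-+-* 3 (toℕ r) (t * 4) ⟩
  3 ^ toℕ r * 3 ^ (t * 4)       ≡⟨ cong (3 ^ toℕ r *_) 3^[t*4]≡1+c*80 ⟩
  3 ^ toℕ r * (1 + c * 80)      ≡⟨ rhs (3 ^ toℕ r) c ⟩
  3 ^ toℕ r + (3 ^ toℕ r * c * 5) * 16 ∎)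
  where
  open ≡-Reasoning
  lhs : ∀ y → 1 + y * 16 ≡ 2 * (2 * (2 * (2 * y))) + 1
  lhs = solve-∀
  rhs : ∀ y c → y * (1 + c * 80) ≡ y + (y * c * 5) * 16
  rhs = solve-∀
  mismatch : ∀ r → 1 + 2 ^ w * 16 ≡ 3 ^ toℕ r + (3 ^ toℕ r * c * 5) * 16 → ⊥
  mismatch 0F e = 5∤2^n w (divides (1 * c) (*-cancelʳ-≡ (2 ^ w) (1 * c * 5) 16 (suc-injective e)))
  mismatch 1F e = contradiction (m+kn≡o+ln⇒m%n≡o%n 1 (2 ^ w) 3 (3 * c * 5) 16 e) λ ()
  mismatch 2F e = contradiction (m+kn≡o+ln⇒m%n≡o%n 1 (2 ^ w) 9 (9 * c * 5) 16 e) λ ()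
  mismatch 3F e = contradiction (m+kn≡o+ln⇒m%n≡o%n 1 (2 ^ w) 27 (27 * c * 5) 16 e) λ ()

2^[1+u*2]≡2∨8[mod30] : ∀ u → ∃[ k ] (2 ^ (1 + u * 2) ≡ 2 + k * 30 ⊎ 2 ^ (1 + u * 2) ≡ 8 + k * 30)
2^[1+u*2]≡2∨8[mod30] zero = 0 , inj₁ refl
2^[1+u*2]≡2∨8[mod30] (suc u) with 2^[1+u*2]≡2∨8[mod30] u
... | k , inj₁ x≡2+k*30 = k * 4 , inj₂ (trans (cong (λ x → 2 * (2 * x)) x≡2+k*30) (from2 k))
  where
  from2 : ∀ k → 2 * (2 * (2 + k * 30)) ≡ 8 + (k * 4) * 30
  from2 = solve-∀
... | k , inj₂ x≡8+k*30 = 1 + k * 4 , inj₁ (trans (cong (λ x → 2 * (2 * x)) x≡8+k*30) (from8 k))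
  where
  from8 : ∀ k → 2 * (2 * (8 + k * 30)) ≡ 2 + (1 + k * 4) * 30
  from8 = solve-∀

primeFactor-≤√ : ∀ n → 1 < n → ∃[ q ] (Prime q × q ∣ n × (q ≡ n ⊎ q * q ≤ n))
primeFactor-≤√ n 1<n = search (n ∸ 2) 0 (m+[n∸m]≡n 1<n) 2-rough
  where
  instance _ = n>1⇒nonTrivial 1<n
  search : ∀ k j → 2 + j + k ≡ n → (2 + j) Rough n → ∃[ q ] (Prime q × q ∣ n × (q ≡ n ⊎ q * q ≤ n))
  search k j eq rough with (2 + j) * (2 + j) ≤? n | (2 + j) ∣? n | k
  ... | no [2+j]²≰n | _ | _ = n , rough∧square>⇒prime rough (≰⇒> [2+j]²≰n) , ∣-refl , inj₁ refl
  ... | yes [2+j]²≤n | yes 2+j∣n | _ = 2 + j , rough∧∣⇒prime rough 2+j∣n , 2+j∣n , inj₂ [2+j]²≤n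
  ... | yes _ | no 2+j∤n | zero = contradiction (subst (2 + j ∣_) (trans (sym (+-identityʳ _)) eq) ∣-refl) 2+j∤n
  ... | yes _ | no 2+j∤n | suc k = search k (suc j) (trans (sym (+-suc (2 + j) k)) eq) (∤⇒rough-suc 2+j∤n rough)

product-all≡ : ∀ {p ps} → All (_≡ p) ps → product ps ≡ p ^ length ps
product-all≡ All.[] = refl
product-all≡ {p} (refl All.∷ ps≡p) = cong (p *_) (product-all≡ ps≡p)

primeFactor≢ : ∀ p n .{{_ : NonZero n}} → (∀ j → n ≢ p ^ j) → ∃[ q ] (Prime q × q ∣ n × q ≢ p)
primeFactor≢ p n n≢p^j = other-factor (all? (_≟ p) factors)
  where
  open PrimeFactorisation (factorise n)
  other-factor : Dec (All (_≡ p) factors) → ∃[ q ] (Prime q × q ∣ n × q ≢ p)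
  other-factor (yes factors≡p) = contradiction (trans isFactorisation (product-all≡ factors≡p)) (n≢p^j (length factors))
  other-factor (no ¬factors≡p) =
    let q , q∈factors , q≢p = find (¬All⇒Any¬ (_≟ p) factors ¬factors≡p)
    in q , All.lookup factorsPrime q∈factors , subst (q ∣_) (sym isFactorisation) (∈⇒∣product q∈factors) , q≢p

-- Prime factors of 2 ^ (2u + 1) ± 1

record LargeFactors (x : ℕ) : Set where
  field
    p₋ p₊    : ℕ
    p₋-prime : Prime p₋
    p₊-prime : Prime p₊
    5<p₋     : 5 < p₋
    5<p₊     : 5 < p₊
    p₋∣x∸1   : p₋ ∣ x ∸ 1
    p₊∣x+1   : p₊ ∣ x + 1
    p₋≤x∸1   : p₋ ≤ x ∸ 1
    p₊≤x∸1   : p₊ ≤ x ∸ 1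

  p₋≢p₊ : p₋ ≢ p₊
  p₋≢p₊ p₋≡p₊ = <⇒≱ 5<p₋ (≤-trans (∣⇒≤ p₋∣2) (s≤s (s≤s z≤n)))
    where
    x+1≡x∸1+2 : ∀ x → 0 < x ∸ 1 → x + 1 ≡ x ∸ 1 + 2
    x+1≡x∸1+2 (suc x) _ = trans (+-comm (suc x) 1) (+-comm 2 x)
    p₋∣x∸1+2 : p₋ ∣ x ∸ 1 + 2
    p₋∣x∸1+2 = subst₂ _∣_ (sym p₋≡p₊) (x+1≡x∸1+2 x (≤-trans (≤-trans (s≤s z≤n) 5<p₋) p₋≤x∸1)) p₊∣x+1
    p₋∣2 : p₋ ∣ 2
    p₋∣2 = ∣m+n∣m⇒∣n p₋∣x∸1+2 p₋∣x∸1

largeFactors-from : ∀ w a m .{{_ : NonZero m}} → 2 ^ (4 + w) ≡ suc a → suc a + 1 ≡ 3 * m → m ≤ a →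
                    ¬ 2 ∣ a → ¬ 3 ∣ a → ¬ 5 ∣ a → ¬ 2 ∣ m → ¬ 5 ∣ m → LargeFactors (suc a)
largeFactors-from w a m x≡1+a x+1≡3m m≤a 2∤a 3∤a 5∤a 2∤m 5∤m =
  assemble (primeFactor-≤√ a 1<a) (primeFactor≢ 3 m m≢3^j)
  where
  1<a : 1 < a
  1<a = ≤-pred (subst (2 <_) x≡1+a (≤-trans (s≤s (s≤s (s≤s z≤n))) (^-monoʳ-≤ 2 (m≤m+n 4 w))))
  m≢3^j : ∀ j → m ≢ 3 ^ j
  m≢3^j j m≡3^j = 2^[4+w]+1≢3^j w (suc j) (trans (cong (_+ 1) x≡1+a) (trans x+1≡3m (cong (3 *_) m≡3^j)))
  assemble : ∃[ p ] (Prime p × p ∣ a × (p ≡ a ⊎ p * p ≤ a)) → ∃[ q ] (Prime q × q ∣ m × q ≢ 3) →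
             LargeFactors (suc a)
  assemble (p , p-prime , p∣a , _) (q , q-prime , q∣m , q≢3) = record
    { p₋ = p ; p₊ = q ; p₋-prime = p-prime ; p₊-prime = q-prime
    ; 5<p₋ = prime∣n⇒5<p p-prime p∣a 2∤a 3∤a 5∤a
    ; 5<p₊ = prime>5 q-prime (∣∧∤⇒≢ q∣m 2∤m) q≢3 (∣∧∤⇒≢ q∣m 5∤m)
    ; p₋∣x∸1 = p∣a
    ; p₊∣x+1 = ∣-trans q∣m (divides 3 x+1≡3m)
    ; p₋≤x∸1 = ∣⇒≤ {{>-nonZero (<-trans z<s 1<a)}} p∣a
    ; p₊≤x∸1 = ≤-trans (∣⇒≤ q∣m) m≤a
    }

largeFactors : ∀ u → 2 ≤ u → LargeFactors (2 ^ (1 + u * 2))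
largeFactors u@(suc (suc u′)) _ with 2^[1+u*2]≡2∨8[mod30] u
... | k , inj₁ x≡2+k*30 = subst LargeFactors (sym x≡2+k*30)
  (largeFactors-from (1 + u′ * 2) (1 + k * 30) (1 + k * 10) x≡2+k*30 (x+1≡3*m k)
    (s≤s (*-monoʳ-≤ k (m≤m+n 10 20)))
    (∤r+k*n 1 30 k) (∤r+k*n 1 30 k) (∤r+k*n 1 30 k) (∤r+k*n 1 10 k) (∤r+k*n 1 10 k))
  where
  x+1≡3*m : ∀ k → 2 + k * 30 + 1 ≡ 3 * (1 + k * 10)
  x+1≡3*m = solve-∀
... | k , inj₂ x≡8+k*30 = subst LargeFactors (sym x≡8+k*30)
  (largeFactors-from (1 + u′ * 2) (7 + k * 30) (3 + k * 10) x≡8+k*30 (x+1≡3*m k)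
    (+-mono-≤ (m≤m+n 3 4) (*-monoʳ-≤ k (m≤m+n 10 20)))
    (∤r+k*n 7 30 k) (∤r+k*n 7 30 k) (∤r+k*n 7 30 k) (∤r+k*n 3 10 k) (∤r+k*n 3 10 k))
  where
  x+1≡3*m : ∀ k → 8 + k * 30 + 1 ≡ 3 * (3 + k * 10)
  x+1≡3*m = solve-∀
largeFactors (suc zero) (s≤s ())

-- y and z stand for 2 ^ (s ∸ 1) and 2 ^ s; keeping them abstract lets each case be proved
-- for explicit residue forms of these powers and transported back along an equation.
Admissible : ℕ → ℕ → ℕ → Set
Admissible y z q = q ≡ y ∸ 1 ⊎ q ≡ z + 1 ⊎ (5 < q × q * q ≤ z ∸ 3)

Alternatives : ℕ → ℕ → ℕ → ℕ → ℕ → Set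
Alternatives y z s δ N =
    (δ ≡ 0 × (∃[ q₁ ] ∃[ q₂ ] (q₁ ≢ q₂ × Prime q₁ × Prime q₂ × q₁ ∣ N × q₂ ∣ N
        × (5 < q₁ × q₁ ≤ z ∸ 1) × (5 < q₂ × q₂ ≤ z ∸ 1))))
    ⊎ 5 ∣ N
    ⊎ (∃[ q₁ ] ∃[ q₂ ] (q₁ ≢ q₂ × Prime q₁ × Prime q₂ × q₁ ∣ N × q₂ ∣ N
        × Admissible y z q₁ × Admissible y z q₂
        × ((q₁ ≡ y ∸ 1 ⊎ q₁ ≡ z + 1 ⊎ q₂ ≡ y ∸ 1 ⊎ q₂ ≡ z + 1) → (4 ∣ s × δ ≡ 1))))

Conclusion : ℕ → ℕ → ℕ → Set
Conclusion s = Alternatives (2 ^ (s ∸ 1)) (2 ^ s) s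

alternative-a : ∀ y x s → LargeFactors x → Alternatives y x s 0 ((x ∸ 1) * (x + 1))
alternative-a y x s L = inj₁ (refl , p₋ , p₊ , p₋≢p₊ , p₋-prime , p₊-prime ,
  ∣m⇒∣m*n (x + 1) p₋∣x∸1 , ∣n⇒∣m*n (x ∸ 1) p₊∣x+1 , (5<p₋ , p₋≤x∸1) , (5<p₊ , p₊≤x∸1))
  where open LargeFactors L

alternative-c-square : ∀ x s → LargeFactors x →
  Alternatives (x * x) (2 * (x * x)) s 1 ((x * x ∸ 1) * (2 * (x * x) + 1))
alternative-c-square x s L = inj₂ (inj₂ (p₋ , p₊ , p₋≢p₊ , p₋-prime , p₊-prime ,
  ∣m⇒∣m*n (2 * (x * x) + 1) (∣-trans p₋∣x∸1 x∸1∣x²∸1) , ∣m⇒∣m*n (2 * (x * x) + 1) (∣-trans p₊∣x+1 x+1∣x²∸1) ,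
  admissible p₋≤x∸1 5<p₋ , admissible p₊≤x∸1 5<p₊ , not-special))
  where
  open LargeFactors L
  6≤x : 6 ≤ x
  6≤x = ≤-trans (≤-trans 5<p₋ p₋≤x∸1) (m∸n≤m x 1)
  x²∸1≡[x∸1]*[x+1] : ∀ x → 0 < x → x * x ∸ 1 ≡ (x ∸ 1) * (x + 1)
  x²∸1≡[x∸1]*[x+1] (suc y) _ = expand y
    where
    expand : ∀ y → y + y * suc y ≡ y * (suc y + 1)
    expand = solve-∀
  x∸1∣x²∸1 : x ∸ 1 ∣ x * x ∸ 1
  x∸1∣x²∸1 = divides (x + 1) (trans (x²∸1≡[x∸1]*[x+1] x (≤-trans (s≤s z≤n) 6≤x)) (*-comm (x ∸ 1) (x + 1)))
  x+1∣x²∸1 : x + 1 ∣ x * x ∸ 1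
  x+1∣x²∸1 = divides (x ∸ 1) (x²∸1≡[x∸1]*[x+1] x (≤-trans (s≤s z≤n) 6≤x))
  x∸1<x²∸1 : ∀ x → 1 < x → x ∸ 1 < x * x ∸ 1
  x∸1<x²∸1 (suc (suc z)) _ = m<m+n (suc z) z<s
  x∸1<x²∸1 (suc zero) (s≤s ())
  x²≤2x²∸3 : x * x ≤ 2 * (x * x) ∸ 3
  x²≤2x²∸3 = n≤2n∸3 (x * x) (≤-trans (≤-trans (m≤m+n 3 3) 6≤x) (m≤m*n x x {{>-nonZero (≤-trans (s≤s z≤n) 6≤x)}}))
  admissible : ∀ {r} → r ≤ x ∸ 1 → 5 < r → Admissible (x * x) (2 * (x * x)) r
  admissible r≤x∸1 5<r = inj₂ (inj₂ (5<r , ≤-trans (*-mono-≤ r≤x r≤x) x²≤2x²∸3))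
    where
    r≤x = ≤-trans r≤x∸1 (m∸n≤m x 1)
  below-special : ∀ {r} → r ≤ x ∸ 1 → r < x * x ∸ 1 × r < 2 * (x * x) + 1
  below-special r≤x∸1 = r<x²∸1 , <-trans r<x²∸1 (≤-<-trans (≤-trans (m∸n≤m (x * x) 1) (m≤m+n (x * x) _)) (m<m+n _ z<s))
    where
    r<x²∸1 = ≤-<-trans r≤x∸1 (x∸1<x²∸1 x (≤-trans (m≤m+n 2 4) 6≤x))
  not-special : (p₋ ≡ x * x ∸ 1 ⊎ p₋ ≡ 2 * (x * x) + 1 ⊎ p₊ ≡ x * x ∸ 1 ⊎ p₊ ≡ 2 * (x * x) + 1) → 4 ∣ s × 1 ≡ 1
  not-special (inj₁ p₋≡) = contradiction p₋≡ (<⇒≢ (proj₁ (below-special p₋≤x∸1)))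
  not-special (inj₂ (inj₁ p₋≡)) = contradiction p₋≡ (<⇒≢ (proj₂ (below-special p₋≤x∸1)))
  not-special (inj₂ (inj₂ (inj₁ p₊≡))) = contradiction p₊≡ (<⇒≢ (proj₁ (below-special p₊≤x∸1)))
  not-special (inj₂ (inj₂ (inj₂ p₊≡))) = contradiction p₊≡ (<⇒≢ (proj₂ (below-special p₊≤x∸1)))

-- A = 2 ^ (s ∸ 1) ∸ 1 and B = 2 ^ s + 1 = 2 A + 3 are prime to 30, so prime factors of A and B
-- are distinct and exceed 5; and B ≡ 5 (mod 12) while q² ≡ 1 (mod 12), so q² ≤ B forces q² ≤ B ∸ 4.
alternative-c-mod120 : ∀ s c → 4 ∣ s →
  Alternatives (8 + c * 120) (16 + c * 240) s 1 ((7 + c * 120) * (16 + c * 240 + 1))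
alternative-c-mod120 s c 4∣s = assemble (primeFactor-≤√ A (s≤s (s≤s z≤n))) (primeFactor-≤√ B (s≤s (s≤s z≤n)))
  where
  A = 7 + c * 120
  B = 16 + c * 240 + 1
  B≡17+c*240 : B ≡ 17 + c * 240
  B≡17+c*240 = +-comm (16 + c * 240) 1
  B≡2A+3 : B ≡ 2 * A + 3
  B≡2A+3 = regroup c
    where
    regroup : ∀ c → 16 + c * 240 + 1 ≡ 2 * (7 + c * 120) + 3
    regroup = solve-∀
  B≡5+m*12 : B ≡ 5 + (1 + c * 20) * 12
  B≡5+m*12 = regroup c
    where
    regroup : ∀ c → 16 + c * 240 + 1 ≡ 5 + (1 + c * 20) * 12
    regroup = solve-∀
  1+m*12≡B∸4 : 1 + (1 + c * 20) * 12 ≡ 13 + c * 240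
  1+m*12≡B∸4 = regroup c
    where
    regroup : ∀ c → 1 + (1 + c * 20) * 12 ≡ 13 + c * 240
    regroup = solve-∀
  ∤B : ∀ {d} → {True (d ∣? 240)} → {False (d ∣? 17)} → ¬ d ∣ B
  ∤B {d} {d∣240} {d∤17} = ∤r+k*n 17 240 c {d∣240} {d∤17} ∘ subst (d ∣_) B≡17+c*240
  assemble : ∃[ q ] (Prime q × q ∣ A × (q ≡ A ⊎ q * q ≤ A)) → ∃[ q ] (Prime q × q ∣ B × (q ≡ B ⊎ q * q ≤ B)) →
             Alternatives (8 + c * 120) (16 + c * 240) s 1 (A * B)
  assemble (q₁ , q₁-prime , q₁∣A , q₁≡A⊎q₁²≤A) (q₂ , q₂-prime , q₂∣B , q₂≡B⊎q₂²≤B) =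
    inj₂ (inj₂ (q₁ , q₂ , q₁≢q₂ , q₁-prime , q₂-prime , ∣m⇒∣m*n {m = A} B q₁∣A , ∣n⇒∣m*n A {n = B} q₂∣B ,
      admissible₁ q₁≡A⊎q₁²≤A , admissible₂ q₂≡B⊎q₂²≤B , λ _ → 4∣s , refl))
    where
    5<q₁ : 5 < q₁
    5<q₁ = prime∣n⇒5<p q₁-prime q₁∣A (∤r+k*n 7 120 c) (∤r+k*n 7 120 c) (∤r+k*n 7 120 c)
    5<q₂ : 5 < q₂
    5<q₂ = prime∣n⇒5<p q₂-prime q₂∣B ∤B ∤B ∤B
    q₁≢q₂ : q₁ ≢ q₂
    q₁≢q₂ q₁≡q₂ = <⇒≱ 5<q₁ (≤-trans (∣⇒≤ q₁∣3) (s≤s (s≤s (s≤s z≤n))))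
      where
      q₁∣3 : q₁ ∣ 3
      q₁∣3 = ∣m+n∣m⇒∣n (subst₂ _∣_ (sym q₁≡q₂) B≡2A+3 q₂∣B) (∣n⇒∣m*n 2 q₁∣A)
    admissible₁ : q₁ ≡ A ⊎ q₁ * q₁ ≤ A → Admissible (8 + c * 120) (16 + c * 240) q₁
    admissible₁ (inj₁ q₁≡A) = inj₁ q₁≡A
    admissible₁ (inj₂ q₁²≤A) = inj₂ (inj₂ (5<q₁ , ≤-trans q₁²≤A (+-mono-≤ (m≤m+n 7 6) (*-monoʳ-≤ c (m≤m+n 120 120)))))
    admissible₂ : q₂ ≡ B ⊎ q₂ * q₂ ≤ B → Admissible (8 + c * 120) (16 + c * 240) q₂
    admissible₂ (inj₁ q₂≡B) = inj₂ (inj₁ q₂≡B)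
    admissible₂ (inj₂ q₂²≤B) = inj₂ (inj₂ (5<q₂ , subst (q₂ * q₂ ≤_) 1+m*12≡B∸4
      (square≤5+m*12⇒≤1+m*12 q₂ (1 + c * 20) (λ 2∣q₂ → ∤B (∣-trans 2∣q₂ q₂∣B))
        (λ 3∣q₂ → ∤B (∣-trans 3∣q₂ q₂∣B)) (subst (q₂ * q₂ ≤_) B≡5+m*12 q₂²≤B))))

conclusion-δ≡0 : ∀ s → 4 ≤ s → Conclusion s 0 ((2 ^ s ∸ 1) * (2 ^ s + 1))
conclusion-δ≡0 s 4≤s with s divMod 4
... | result zero 1F refl = contradiction 4≤s λ { (s≤s ()) }
... | result zero 3F refl = contradiction 4≤s λ { (s≤s (s≤s (s≤s ()))) }
... | result t 0F refl = inj₂ (inj₁ (∣m⇒∣m*n (2 ^ (t * 4) + 1) (5∣2^[t*4]∸1 t)))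
... | result t 2F refl = inj₂ (inj₁ (∣n⇒∣m*n (2 ^ (2 + t * 4) ∸ 1) (5∣2^[2+t*4]+1 t)))
... | result t@(suc _) 1F refl = alternative-a (2 ^ (t * 4)) (2 ^ (1 + t * 4)) (1 + t * 4)
  (subst (λ j → LargeFactors (2 ^ (1 + j))) (*-assoc t 2 2) (largeFactors (t * 2) (s≤s (s≤s z≤n))))
... | result t@(suc _) 3F refl = alternative-a (2 ^ (2 + t * 4)) (2 ^ (3 + t * 4)) (3 + t * 4)
  (subst (λ j → LargeFactors (2 ^ (3 + j))) (*-assoc t 2 2) (largeFactors (1 + t * 2) (s≤s (s≤s z≤n))))

conclusion-δ≡1 : ∀ s → 4 ≤ s → s ≢ 7 → Conclusion s 1 ((2 ^ (s ∸ 1) ∸ 1) * (2 ^ s + 1))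
conclusion-δ≡1 s 4≤s s≢7 with s divMod 4
... | result zero 0F refl = contradiction 4≤s λ ()
... | result zero 3F refl = contradiction 4≤s λ { (s≤s (s≤s (s≤s ()))) }
... | result 1 3F refl = contradiction refl s≢7
... | result t 1F refl = inj₂ (inj₁ (∣m⇒∣m*n (2 ^ (1 + t * 4) + 1) (5∣2^[t*4]∸1 t)))
... | result t 2F refl = inj₂ (inj₁ (∣n⇒∣m*n (2 ^ (1 + t * 4) ∸ 1) (5∣2^[2+t*4]+1 t)))
... | result (suc t) 0F refl =
  let c , 2^[s∸1]≡8+c*120 , 2^s≡16+c*240 = 2^[3+t*4]≡8+c*120 t in
  subst₂ (λ y z → Alternatives y z (4 + t * 4) 1 ((y ∸ 1) * (z + 1))) (sym 2^[s∸1]≡8+c*120) (sym 2^s≡16+c*240)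
    (alternative-c-mod120 (4 + t * 4) c (divides (suc t) refl))
... | result t@(suc (suc _)) 3F refl =
  subst₂ (λ y z → Alternatives y z (3 + t * 4) 1 ((y ∸ 1) * (z + 1))) (sym 2^[2+t*4]≡x²) (sym (cong (2 *_) 2^[2+t*4]≡x²))
    (alternative-c-square (2 ^ (1 + t * 2)) (3 + t * 4) (largeFactors t (s≤s (s≤s z≤n))))
  where
  2^[2+t*4]≡x² : 2 ^ (2 + t * 4) ≡ 2 ^ (1 + t * 2) * 2 ^ (1 + t * 2)
  2^[2+t*4]≡x² = trans (cong (2 ^_) (halves t)) (^-distribˡ-+-* 2 (1 + t * 2) (1 + t * 2))
    where
    halves : ∀ t → 2 + t * 4 ≡ (1 + t * 2) + (1 + t * 2)
    halves = solve-∀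

conclusion : ∀ s δ → δ ≤ 1 → 4 ≤ s → (δ ≡ 1 → s ≢ 7) → Conclusion s δ ((2 ^ (s ∸ δ) ∸ 1) * (2 ^ s + 1))
conclusion s zero _ 4≤s _ = conclusion-δ≡0 s 4≤s
conclusion s (suc zero) _ 4≤s s≢7 = conclusion-δ≡1 s 4≤s (s≢7 refl)
conclusion s (suc (suc _)) (s≤s ()) _ _

lemma2p6 : (e s δ : ℕ) → 6 ≤ e → δ ≤ 1 → e + 1 + δ ≡ 2 * s → e ≢ 8 → e ≢ 12 →
    -- (a)
    (δ ≡ 0 × (∃[ q₁ ] ∃[ q₂ ] (q₁ ≢ q₂ × Prime q₁ × Prime q₂ × q₁ ∣ σ** (2 ^ e) × q₂ ∣ σ** (2 ^ e)
        × (5 < q₁ × q₁ ≤ 2 ^ s ∸ 1) × (5 < q₂ × q₂ ≤ 2 ^ s ∸ 1))))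
    ⊎
    -- (b)
    (5 ∣ σ** (2 ^ e))
    ⊎
    -- (c)
    (∃[ q₁ ] ∃[ q₂ ] (q₁ ≢ q₂ × Prime q₁ × Prime q₂ × q₁ ∣ σ** (2 ^ e) × q₂ ∣ σ** (2 ^ e)
        × (q₁ ≡ 2 ^ (s ∸ 1) ∸ 1 ⊎ q₁ ≡ 2 ^ s + 1 ⊎ (5 < q₁ × q₁ * q₁ ≤ 2 ^ s ∸ 3))
        × (q₂ ≡ 2 ^ (s ∸ 1) ∸ 1 ⊎ q₂ ≡ 2 ^ s + 1 ⊎ (5 < q₂ × q₂ * q₂ ≤ 2 ^ s ∸ 3))
        × ((q₁ ≡ 2 ^ (s ∸ 1) ∸ 1 ⊎ q₁ ≡ 2 ^ s + 1 ⊎ q₂ ≡ 2 ^ (s ∸ 1) ∸ 1 ⊎ q₂ ≡ 2 ^ s + 1)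
           → (4 ∣ s × δ ≡ 1))))
lemma2p6 e s δ 6≤e δ≤1 e+1+δ≡2s _ e≢12 =
  subst (Conclusion s δ) (sym (σ**[2^e] e s δ δ≤1 e+1+δ≡2s (≤-trans (s≤s z≤n) 6≤e))) (conclusion s δ δ≤1 4≤s s≢7)
  where
  4≤s : 4 ≤ s
  4≤s = ≰⇒> λ s≤3 → <⇒≱ (≤-trans (+-monoˡ-≤ 1 6≤e) (m≤m+n (e + 1) δ))
    (subst (_≤ 6) (sym e+1+δ≡2s) (*-monoʳ-≤ 2 s≤3))
  s≢7 : δ ≡ 1 → s ≢ 7
  s≢7 refl refl = e≢12 (+-cancelʳ-≡ 2 e 12 (trans (sym (+-assoc e 1 1)) e+1+δ≡2s))
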